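{- Let $F=(S,\sqsubseteq,\{N_i\}_{i\in I})$ be a neighborhood possibility foundation. The following are equivalent: (1) $\mathcal{RO}(S,\sqsubseteq)$ is closed under $\Box_{N_i}$ for every $i\in I$; (2) for each $i\in I$, $F$ satisfies $N_i$-persistence and $N_i$-refinability.
   Context: For a poset $(S,\sqsubseteq)$, $\mathcal{RO}(S,\sqsubseteq)$ is the set of $U\subseteq S$ with $U=\{x\mid\forall x'\sqsubseteq x\ \exists x''\sqsubseteq x':x''\in U\}$. A neighborhood possibility foundation is $(S,\sqsubseteq,\{N_i\}_{i\in I})$ with $(S,\sqsubseteq)$ a poset and each $N_i:S\to\wp(\mathcal{RO}(S,\sqsubseteq))$. For $U\in\mathcal{RO}(S,\sqsubseteq)$, $\Box_{N_i}U=\{x\in S\mid U\in N_i(x)\}$. $N_i$-persistence: if $x'\sqsubseteq x$ then $N_i(x')\supseteq N_i(x)$. $N_i$-refinability: for every $U\in\mathcal{RO}(S,\sqsubseteq)$ and $x\in S$, if $U\notin N_i(x)$ then $\exists x'\sqsubseteq x\ \forall x''\sqsubseteq x'\ U\notin N_i(x'')$. -}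

module Defs where

open import Level using (Level; _⊔_; suc)
open import Data.Product using (Σ; _×_; _,_)
open import Relation.Binary.Bundles using (Poset)
open import Relation.Unary using (Pred; _∈_; _∉_)
open import Function.Bundles using (_⇔_)

module _ {c ℓ₁ ℓ₂ : Level} (P : Poset c ℓ₁ ℓ₂) where
  open Poset P renaming (Carrier to S; _≤_ to _⊑_)

  IsRO : {ℓ : Level} → Pred S ℓ → Set (c ⊔ ℓ₂ ⊔ ℓ)
  IsRO U = ∀ x → (x ∈ U) ⇔ (∀ x' → x' ⊑ x → Σ S λ x'' → x'' ⊑ x' × x'' ∈ U)

-- Subsets of S are predicates of level ℓ; N i x is a set of subsets of S
-- (membership of level ℓ') which contains only regular open sets,
-- i.e. N_i : S → ℘(RO(S,⊑)).
record NbhdFoundation (c ℓ₁ ℓ₂ ι ℓ ℓ' : Level)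
       : Set (suc (c ⊔ ℓ₁ ⊔ ℓ₂ ⊔ ι ⊔ ℓ ⊔ ℓ')) where
  field
    poset : Poset c ℓ₁ ℓ₂
  open Poset poset public renaming (Carrier to S; _≤_ to _⊑_)
  field
    I    : Set ι
    N    : I → S → Pred (Pred S ℓ) ℓ'
    N-RO : ∀ i x (U : Pred S ℓ) → U ∈ N i x → IsRO poset U

  Box : I → Pred S ℓ → Pred S ℓ'
  Box i U x = U ∈ N i x

  ROClosedUnder : I → Set (c ⊔ ℓ₂ ⊔ suc ℓ ⊔ ℓ')
  ROClosedUnder i = ∀ (U : Pred S ℓ) → IsRO poset U → IsRO poset (Box i U)

  Persistence : I → Set (c ⊔ ℓ₂ ⊔ suc ℓ ⊔ ℓ')
  Persistence i = ∀ {x x'} → x' ⊑ x → ∀ (U : Pred S ℓ) → U ∈ N i x → U ∈ N i x'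

  Refinability : I → Set (c ⊔ ℓ₂ ⊔ suc ℓ ⊔ ℓ')
  Refinability i = ∀ (U : Pred S ℓ) → IsRO poset U → ∀ x → U ∉ N i x →
    Σ S λ x' → x' ⊑ x × (∀ x'' → x'' ⊑ x' → U ∉ N i x'')

-- Classically, a set V is regular open exactly when it is downward closed and
-- every point outside V has a refinement all of whose refinements lie outside
-- V.  For V = □_{N_i} U the first condition is N_i-persistence and the second
-- is N_i-refinability; persistence for arbitrary U reduces to regular open U
-- because N_i(x) only contains regular open sets.
module Submission where

open import Defs
open import Level using (Level)
open import Data.Product using (_×_; Σ; _,_)
open import Function.Bundles using (_⇔_; mk⇔; Equivalence)
open import Axiom.ExcludedMiddle using (ExcludedMiddle)
open import Axiom.DoubleNegationElimination using (em⇒dne)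
open import Relation.Binary.Bundles using (Poset)
open import Relation.Unary using (Pred; _∈_; _∉_)

module _ {c ℓ₁ ℓ₂ : Level} (P : Poset c ℓ₁ ℓ₂) where
  open Poset P renaming (Carrier to S; _≤_ to _⊑_)

  DownClosed : {k : Level} → Pred S k → Set _
  DownClosed V = ∀ {x y} → y ⊑ x → x ∈ V → y ∈ V

  Refinable : {k : Level} → Pred S k → Set _
  Refinable V = ∀ x → x ∉ V → Σ S λ x' → x' ⊑ x × (∀ x'' → x'' ⊑ x' → x'' ∉ V)

  IsRO⇒downClosed : {k : Level} {V : Pred S k} → IsRO P V → DownClosed V
  IsRO⇒downClosed ro {x} {y} y⊑x x∈V = Equivalence.from (ro y)
    λ y' y'⊑y → Equivalence.to (ro x) x∈V y' (trans y'⊑y y⊑x)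

  IsRO⇒refinable : (∀ {a} → ExcludedMiddle a) →
                   {k : Level} {V : Pred S k} → IsRO P V → Refinable V
  IsRO⇒refinable em ro x x∉V = em⇒dne em λ noRefinement →
    x∉V (Equivalence.from (ro x) λ x' x'⊑x → em⇒dne em λ noWitness →
      noRefinement (x' , x'⊑x , λ x'' x''⊑x' x''∈V → noWitness (x'' , x''⊑x' , x''∈V)))

  downClosed×refinable⇒IsRO : (∀ {a} → ExcludedMiddle a) →
                              {k : Level} {V : Pred S k} →
                              DownClosed V → Refinable V → IsRO P V
  downClosed×refinable⇒IsRO em down refinable x = mk⇔
    (λ x∈V x' x'⊑x → x' , refl , down x'⊑x x∈V)
    (λ dense → em⇒dne em λ x∉V →
      let (x' , x'⊑x , outside) = refinable x x∉V
          (x'' , x''⊑x' , x''∈V) = dense x' x'⊑x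
      in outside x'' x''⊑x' x''∈V)

module _ {c ℓ₁ ℓ₂ ι ℓ ℓ' : Level} (F : NbhdFoundation c ℓ₁ ℓ₂ ι ℓ ℓ') where
  open NbhdFoundation F

  ROClosed⇒persistence : ∀ i → ROClosedUnder i → Persistence i
  ROClosed⇒persistence i closed {x} x'⊑x U U∈Nx =
    IsRO⇒downClosed poset (closed U (N-RO i x U U∈Nx)) x'⊑x U∈Nx

  ROClosed⇒refinability : (∀ {a} → ExcludedMiddle a) →
                          ∀ i → ROClosedUnder i → Refinability i
  ROClosed⇒refinability em i closed U ro = IsRO⇒refinable poset em (closed U ro)

  persistence×refinability⇒ROClosed : (∀ {a} → ExcludedMiddle a) →
    ∀ i → Persistence i × Refinability i → ROClosedUnder i
  persistence×refinability⇒ROClosed em i (persistent , refinable) U ro =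
    downClosed×refinable⇒IsRO poset em
      (λ y⊑x → persistent y⊑x U) (refinable U ro)

  ROClosed⇒persistence×refinability : (∀ {a} → ExcludedMiddle a) →
    ∀ i → ROClosedUnder i → Persistence i × Refinability i
  ROClosed⇒persistence×refinability em i closed =
    ROClosed⇒persistence i closed , ROClosed⇒refinability em i closed

proposition5p2p4 : {c ℓ₁ ℓ₂ ι ℓ ℓ' : Level} → (∀ {a} → ExcludedMiddle a) →
    (F : NbhdFoundation c ℓ₁ ℓ₂ ι ℓ ℓ') →
    ((∀ i → NbhdFoundation.ROClosedUnder F i) ⇔
    (∀ i → NbhdFoundation.Persistence F i × NbhdFoundation.Refinability F i))
proposition5p2p4 em F = mk⇔
  (λ closed i → ROClosed⇒persistence×refinability F em i (closed i))
  (λ both i → persistence×refinability⇒ROClosed F em i (both i))
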